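{- For a semi-Heyting algebra $\mathbf A$, $\mathbf A$ satisfies $0\to1\approx0$ if and only if $\mathbf A$ satisfies $(x^*\to x)^*\approx1$. Thus $\mathbb{AH}=\mathbb{AT}1$.
   Context: A semi-Heyting algebra is an algebra $\langle A;\wedge,\vee,\to,0,1\rangle$ such that $\langle A;\wedge,\vee,0,1\rangle$ is a bounded lattice and the identities $x\wedge(x\to y)\approx x\wedge y$, $x\wedge(y\to z)\approx x\wedge((x\wedge y)\to(x\wedge z))$, $x\to x\approx1$ hold. Write $x^*:=x\to0$. $\mathbb{AH}$ (anti-Heyting algebras) is the variety of semi-Heyting algebras satisfying $0\to1\approx0$; $\mathbb{AT}1$ is the variety of semi-Heyting algebras satisfying $(x^*\to x)^*\approx1$. -}

module Defs where

open import Level using (Level; suc; _⊔_)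
open import Relation.Binary.Core using (Rel)
open import Algebra.Core using (Op₂)
open import Algebra.Definitions using (Congruent₂; Identity)
open import Algebra.Lattice.Structures using (IsLattice)

record SemiHeytingAlgebra (c ℓ : Level) : Set (suc (c ⊔ ℓ)) where
  infixr 5 _⇒_
  infixr 6 _∨_
  infixr 7 _∧_
  infix  4 _≈_
  field
    Carrier   : Set c
    _≈_       : Rel Carrier ℓ
    _∨_       : Op₂ Carrier
    _∧_       : Op₂ Carrier
    _⇒_       : Op₂ Carrier
    𝟘         : Carrier
    𝟙         : Carrier
    isLattice : IsLattice _≈_ _∨_ _∧_
    ∨-identity : Identity _≈_ 𝟘 _∨_
    ∧-identity : Identity _≈_ 𝟙 _∧_
    ⇒-cong    : Congruent₂ _≈_ _⇒_
    ∧-⇒       : ∀ x y → x ∧ (x ⇒ y) ≈ x ∧ y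
    ∧-⇒-rel   : ∀ x y z → x ∧ (y ⇒ z) ≈ x ∧ ((x ∧ y) ⇒ (x ∧ z))
    ⇒-refl    : ∀ x → x ⇒ x ≈ 𝟙

  open IsLattice isLattice public

  _* : Carrier → Carrier
  x * = x ⇒ 𝟘

  IsAntiHeyting : Set ℓ
  IsAntiHeyting = 𝟘 ⇒ 𝟙 ≈ 𝟘

  IsAT1 : Set (c ⊔ ℓ)
  IsAT1 = ∀ x → ((x *) ⇒ x) * ≈ 𝟙

{-# OPTIONS --safe #-}
-- The identity x ∧ (y → z) ≈ x ∧ ((x ∧ y) → (x ∧ z)) makes x ∧ (y → z)
-- depend only on x ∧ y and x ∧ z; in particular x ∧ (x* → x) ≈ x ∧ (0 → 1),
-- while x* ∧ (x* → x) ≈ x* ∧ x ≈ 0. So if 0 → 1 ≈ 0, then x* → x meets both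
-- x and x* in 0, and an element meeting both y and y* in 0 is 0; hence
-- (x* → x)* ≈ 0 → 0 ≈ 1. Conversely 1* ≈ 0, so the identity at x = 1 says
-- (0 → 1)* ≈ 1, and any a with a* ≈ 1 equals a ∧ a* ≈ 0.
module Submission where

open import Defs
open import Level using (Level)
open import Function.Bundles using (_⇔_; mk⇔)
open import Data.Product using (proj₁; proj₂)
open import Algebra.Lattice.Bundles using (Lattice)
import Algebra.Lattice.Properties.Lattice as LatticeProperties
import Relation.Binary.Reasoning.Setoid as SetoidReasoning

module SemiHeytingProperties {c ℓ : Level} (A : SemiHeytingAlgebra c ℓ) where
  open SemiHeytingAlgebra A

  lattice : Lattice c ℓ
  lattice = record { isLattice = isLattice }

  open Lattice lattice using (setoid)
  open LatticeProperties lattice using (∧-idem)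
  open SetoidReasoning setoid

  ∧-zeroʳ : ∀ x → x ∧ 𝟘 ≈ 𝟘
  ∧-zeroʳ x = begin
    x ∧ 𝟘         ≈⟨ ∧-comm x 𝟘 ⟩
    𝟘 ∧ x         ≈⟨ ∧-congˡ (proj₁ ∨-identity x) ⟨
    𝟘 ∧ (𝟘 ∨ x)   ≈⟨ ∧-absorbs-∨ 𝟘 x ⟩
    𝟘             ∎

  ∧-complementʳ : ∀ x → x ∧ (x *) ≈ 𝟘
  ∧-complementʳ x = trans (∧-⇒ x 𝟘) (∧-zeroʳ x)

  𝟙*≈𝟘 : 𝟙 * ≈ 𝟘
  𝟙*≈𝟘 = begin
    𝟙 *           ≈⟨ proj₁ ∧-identity (𝟙 *) ⟨
    𝟙 ∧ (𝟙 *)     ≈⟨ ∧-complementʳ 𝟙 ⟩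
    𝟘             ∎

  ∧-⇒-cong-rel : ∀ {x y y′ z z′} → x ∧ y ≈ x ∧ y′ → x ∧ z ≈ x ∧ z′ →
                 x ∧ (y ⇒ z) ≈ x ∧ (y′ ⇒ z′)
  ∧-⇒-cong-rel {x} {y} {y′} {z} {z′} y≈y′ z≈z′ = begin
    x ∧ (y ⇒ z)                 ≈⟨ ∧-⇒-rel x y z ⟩
    x ∧ ((x ∧ y) ⇒ (x ∧ z))     ≈⟨ ∧-congˡ (⇒-cong y≈y′ z≈z′) ⟩
    x ∧ ((x ∧ y′) ⇒ (x ∧ z′))   ≈⟨ ∧-⇒-rel x y′ z′ ⟨
    x ∧ (y′ ⇒ z′)               ∎

  x∧y≈𝟘⇒x∧y*≈𝟘⇒x≈𝟘 : ∀ {x y} → x ∧ y ≈ 𝟘 → x ∧ (y *) ≈ 𝟘 → x ≈ 𝟘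
  x∧y≈𝟘⇒x∧y*≈𝟘⇒x≈𝟘 {x} {y} x∧y≈𝟘 x∧y*≈𝟘 = begin
    x             ≈⟨ proj₂ ∧-identity x ⟨
    x ∧ 𝟙         ≈⟨ ∧-congˡ (⇒-refl 𝟘) ⟨
    x ∧ (𝟘 ⇒ 𝟘)   ≈⟨ ∧-⇒-cong-rel (trans (∧-zeroʳ x) (sym x∧y≈𝟘)) refl ⟩
    x ∧ (y ⇒ 𝟘)   ≈⟨ x∧y*≈𝟘 ⟩
    𝟘             ∎

  x*≈𝟙⇒x≈𝟘 : ∀ {x} → x * ≈ 𝟙 → x ≈ 𝟘
  x*≈𝟙⇒x≈𝟘 {x} x*≈𝟙 = begin
    x             ≈⟨ proj₂ ∧-identity x ⟨
    x ∧ 𝟙         ≈⟨ ∧-congˡ x*≈𝟙 ⟨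
    x ∧ (x *)     ≈⟨ ∧-complementʳ x ⟩
    𝟘             ∎

  x∧[x*⇒x]≈x∧[𝟘⇒𝟙] : ∀ x → x ∧ (x * ⇒ x) ≈ x ∧ (𝟘 ⇒ 𝟙)
  x∧[x*⇒x]≈x∧[𝟘⇒𝟙] x = ∧-⇒-cong-rel
    (trans (∧-complementʳ x) (sym (∧-zeroʳ x)))
    (trans (∧-idem x) (sym (proj₂ ∧-identity x)))

  x*∧[x*⇒x]≈𝟘 : ∀ x → x * ∧ (x * ⇒ x) ≈ 𝟘
  x*∧[x*⇒x]≈𝟘 x = begin
    x * ∧ (x * ⇒ x)   ≈⟨ ∧-⇒ (x *) x ⟩
    x * ∧ x           ≈⟨ ∧-comm (x *) x ⟩
    x ∧ x *           ≈⟨ ∧-complementʳ x ⟩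
    𝟘                 ∎

  antiHeyting⇒AT1 : IsAntiHeyting → IsAT1
  antiHeyting⇒AT1 𝟘⇒𝟙≈𝟘 x = trans (⇒-cong x*⇒x≈𝟘 refl) (⇒-refl 𝟘)
    where
    x*⇒x≈𝟘 : x * ⇒ x ≈ 𝟘
    x*⇒x≈𝟘 = x∧y≈𝟘⇒x∧y*≈𝟘⇒x≈𝟘
      (begin
        (x * ⇒ x) ∧ x      ≈⟨ ∧-comm _ x ⟩
        x ∧ (x * ⇒ x)      ≈⟨ x∧[x*⇒x]≈x∧[𝟘⇒𝟙] x ⟩
        x ∧ (𝟘 ⇒ 𝟙)        ≈⟨ ∧-congˡ 𝟘⇒𝟙≈𝟘 ⟩
        x ∧ 𝟘              ≈⟨ ∧-zeroʳ x ⟩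
        𝟘                  ∎)
      (trans (∧-comm _ (x *)) (x*∧[x*⇒x]≈𝟘 x))

  AT1⇒antiHeyting : IsAT1 → IsAntiHeyting
  AT1⇒antiHeyting at1 =
    x*≈𝟙⇒x≈𝟘 (trans (⇒-cong (⇒-cong (sym 𝟙*≈𝟘) refl) refl) (at1 𝟙))

theorem9p3 : ∀ {c ℓ : Level} (A : SemiHeytingAlgebra c ℓ) →
    SemiHeytingAlgebra.IsAntiHeyting A ⇔ SemiHeytingAlgebra.IsAT1 A
theorem9p3 A = mk⇔ antiHeyting⇒AT1 AT1⇒antiHeyting
  where open SemiHeytingProperties A
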